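{- Let $b_1,b_2\ge 2$, $s_1,s_2\ge 1$ and $r_1,r_2$ be integers with $\gcd(r_i,s_i)=1$, let $f(x)=\frac{1}{b_1}x+\frac{r_1}{s_1}$, $g(x)=\frac{1}{b_2}x+\frac{r_2}{s_2}$, and assume $\frac{b_1r_1}{(b_1-1)s_1}\neq \frac{b_2r_2}{(b_2-1)s_2}$. Let $\ell\ge0$ be an integer. Then for every sufficiently large positive integer $N$, the rational number $g^N(f^N(x_g))$, where $x_g=\frac{b_2r_2}{(b_2-1)s_2}$ is the fixed point of $g$, written in lowest terms as $r/s$ with $s>0$, satisfies $b_1^{\ell}b_2^{\ell}\mid s$.
   Context: $f^N$ denotes the $N$-fold composition of $f$. The number $g^N(f^N(x_g))$ lies in the attractor of $\{f,g\}$; it is the point with address $g^Nf^Ng^\infty$. -}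

module Defs where

open import Data.Nat as ℕ using (ℕ; zero; suc; _∸_)
open import Data.Integer as ℤ using (ℤ; +_)
open import Data.Rational using (ℚ; _/_; _+_; _*_; 0ℚ)

-- the rational number n / d, for d ≠ 0 (dummy value 0 when d = 0;
-- only ever used with d ≥ 1 under the hypotheses of the statement)
frac : ℤ → ℕ → ℚ
frac n zero    = 0ℚ
frac n (suc d) = n / suc d

affine : ℕ → ℤ → ℕ → ℚ → ℚ
affine b r s x = frac (+ 1) b * x + frac r s

fixpt : ℕ → ℤ → ℕ → ℚ
fixpt b r s = frac (+ b ℤ.* r) ((b ∸ 1) ℕ.* s)

iter : {A : Set} → (A → A) → ℕ → A → A
iter f zero    x = x
iter f (suc n) x = f (iter f n x)

-- Let F and X be the fixed points of f and g. Since f contracts towards F by the factor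
-- 1/b₁, fᴺ X = F + (X − F)/b₁ᴺ, and then gᴺ (fᴺ X) = X + (F − X)(b₁ᴺ − 1)/(b₁b₂)ᴺ. Clearing
-- denominators, (b₁b₂)ᴺ divides t·m·(b₁ᴺ − 1), where t is the reduced denominator of gᴺ (fᴺ X)
-- and m ≠ 0 (because F ≠ X) does not depend on N.
--
-- The gcd of (b₁b₂)ᴺ and b₁ᴺ − 1 only grows linearly in N. Write b₁b₂ = Q g with Q prime to b₁
-- and g dividing a power of b₁, and pick T with b₁ᵀ ≡ 1 (mod Q²). Then b₁ᴺ − 1 divides
-- (b₁ᵀ)ᴺ − 1 = A·(1 + y + ⋯ + yᴺ⁻¹) with y = b₁ᵀ = 1 + A, and a lifting-the-exponent argument
-- shows that the gcd of Qᴺ with this repunit divides N. A divisor of a power of M that is at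
-- most 2ᵏ divides Mᵏ, so for large N the gcd of (b₁b₂)ᴺ with m(b₁ᴺ − 1) divides (b₁b₂)^(N − ℓ),
-- and the remaining factor (b₁b₂)^ℓ must divide t.
{-# OPTIONS --safe #-}
module Submission where

module Arithmetic where

  open import Data.Nat
  open import Data.Nat.Properties
  open import Data.Nat.Divisibility
  open import Data.Nat.GCD
  open import Data.Nat.Coprimality as Coprimality using (Coprime; coprime-divisor)
  open import Data.Nat.Tactic.RingSolver using (solve-∀)
  open import Data.Nat.Induction using (<-wellFounded)
  open import Induction.WellFounded using (Acc; acc)
  open import Data.Nat.DivMod using (_%_; _/_; m≡m%n+[m/n]*n; m%n<n)
  open import Data.Fin using (toℕ; fromℕ<)
  open import Data.Fin.Properties using (pigeonhole; toℕ-fromℕ<)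
  open import Data.Product using (∃; ∃₂; _×_; _,_; proj₁; proj₂)
  open import Data.Sum using (_⊎_; inj₁; inj₂)
  open import Data.Empty using (⊥-elim)
  open import Function.Base using (it)
  open import Relation.Nullary using (yes; no)
  open import Relation.Binary.PropositionalEquality

  coprime-∣ˡ : ∀ {m n d} → d ∣ m → Coprime m n → Coprime d n
  coprime-∣ˡ d∣m c (i∣d , i∣n) = c (∣-trans i∣d d∣m , i∣n)

  coprime-∣ʳ : ∀ {m n d} → d ∣ n → Coprime m n → Coprime m d
  coprime-∣ʳ d∣n c = Coprimality.sym (coprime-∣ˡ d∣n (Coprimality.sym c))

  coprime-*ʳ : ∀ {m n o} → Coprime m n → Coprime m o → Coprime m (n * o)
  coprime-*ʳ c₁ c₂ (i∣m , i∣no) = c₂ (i∣m , coprime-divisor (coprime-∣ˡ i∣m c₁) i∣no)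

  coprime-^ʳ : ∀ {m n} k → Coprime m n → Coprime m (n ^ k)
  coprime-^ʳ zero    c (_ , i∣1) = ∣1⇒≡1 i∣1
  coprime-^ʳ (suc k) c = coprime-*ʳ c (coprime-^ʳ k c)

  coprime-1+* : ∀ m k → Coprime (suc (m * k)) m
  coprime-1+* m k {i} (i∣1+mk , i∣m) =
    ∣1⇒≡1 (∣m+n∣m⇒∣n (subst (i ∣_) (+-comm 1 (m * k)) i∣1+mk) (∣m⇒∣m*n k i∣m))

  ^-distribʳ-* : ∀ m n k → (m * n) ^ k ≡ m ^ k * n ^ k
  ^-distribʳ-* m n zero    = refl
  ^-distribʳ-* m n (suc k) = trans (cong (m * n *_) (^-distribʳ-* m n k)) (interchange m n (m ^ k) (n ^ k))
    where
    interchange : ∀ a b c d → a * b * (c * d) ≡ a * c * (b * d)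
    interchange = solve-∀

  gcd[m,n*o]∣n*gcd[m,o] : ∀ m n o → gcd m (n * o) ∣ n * gcd m o
  gcd[m,n*o]∣n*gcd[m,o] m n o = subst (gcd m (n * o) ∣_) (sym (c*gcd[m,n]≡gcd[cm,cn] n m o))
    (gcd-greatest (∣-trans (gcd[m,n]∣m m (n * o)) (n∣m*n n)) (gcd[m,n]∣n m (n * o)))

  gcd[m,n*o]≡gcd[m,n*gcd[m,o]] : ∀ m n o → gcd m (n * o) ≡ gcd m (n * gcd m o)
  gcd[m,n*o]≡gcd[m,n*gcd[m,o]] m n o = ∣-antisym
    (gcd-greatest (gcd[m,n]∣m m (n * o)) (gcd[m,n*o]∣n*gcd[m,o] m n o))
    (gcd-greatest (gcd[m,n]∣m m _) (∣-trans (gcd[m,n]∣n m _) (*-monoʳ-∣ n (gcd[m,n]∣n m o))))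

  gcd-nonZeroˡ : ∀ m n .{{_ : NonZero m}} → NonZero (gcd m n)
  gcd-nonZeroˡ m n = ≢-nonZero (gcd[m,n]≢0 m n (inj₁ (≢-nonZero⁻¹ m)))

  n<2^n : ∀ n → n < 2 ^ n
  n<2^n zero    = s≤s z≤n
  n<2^n (suc n) = ≤-trans (+-mono-≤ (≤-trans (s≤s z≤n) (n<2^n n)) (n<2^n n))
                           (≤-reflexive (cong (2 ^ n +_) (sym (+-identityʳ (2 ^ n)))))

  ∣∧≢⇒2*≤ : ∀ {m n} → .{{NonZero n}} → m ∣ n → m ≢ n → 2 * m ≤ n
  ∣∧≢⇒2*≤ {m} {n} (divides zero eq)          _   = ⊥-elim (≢-nonZero⁻¹ n eq)
  ∣∧≢⇒2*≤ {m} {n} (divides (suc zero) eq)    m≢n = ⊥-elim (m≢n (sym (trans eq (+-identityʳ m))))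
  ∣∧≢⇒2*≤ {m} {n} (divides (suc (suc k)) eq) _   = begin
    2 * m           ≡⟨ cong (m +_) (+-identityʳ m) ⟩
    m + m           ≤⟨ +-monoʳ-≤ m (m≤m+n m (k * m)) ⟩
    suc (suc k) * m ≡⟨ sym eq ⟩
    n               ∎
    where open ≤-Reasoning

  -- The chain gcd(e, Xⁱ) increases in the divisibility order and, once two consecutive
  -- terms agree, stays constant; before that it at least doubles at every step.
  module PowerGcd (e X : ℕ) .{{_ : NonZero e}} where

    chain : ℕ → ℕ
    chain i = gcd e (X ^ i)

    chain-stable-step : ∀ i → chain (suc i) ≡ chain i → chain (suc (suc i)) ≡ chain (suc i)
    chain-stable-step i stable = begin
      gcd e (X * X ^ suc i)       ≡⟨ gcd[m,n*o]≡gcd[m,n*gcd[m,o]] e X (X ^ suc i) ⟩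
      gcd e (X * chain (suc i))   ≡⟨ cong (λ v → gcd e (X * v)) stable ⟩
      gcd e (X * chain i)         ≡⟨ sym (gcd[m,n*o]≡gcd[m,n*gcd[m,o]] e X (X ^ i)) ⟩
      gcd e (X * X ^ i)           ∎
      where open ≡-Reasoning

    chain-stable : ∀ i → chain (suc i) ≡ chain i → ∀ n → chain (n + i) ≡ chain i
    chain-stable i stable zero    = refl
    chain-stable i stable (suc n) = trans (step n) (chain-stable i stable n)
      where
      step : ∀ n → chain (suc (n + i)) ≡ chain (n + i)
      step zero    = stable
      step (suc n) = chain-stable-step (n + i) (step n)

    chain-doubles : ∀ i → chain (suc i) ≢ chain i → 2 * chain i ≤ chain (suc i)
    chain-doubles i grows = ∣∧≢⇒2*≤ {{gcd-nonZeroˡ e (X ^ suc i)}}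
      (gcd-greatest (gcd[m,n]∣m e (X ^ i)) (∣-trans (gcd[m,n]∣n e (X ^ i)) (n∣m*n X)))
      (λ eq → grows (sym eq))

    chain-stable-or-large : ∀ i → chain (suc i) ≡ chain i ⊎ 2 ^ suc i ≤ chain (suc i)
    chain-stable-or-large i with chain (suc i) ≟ chain i
    chain-stable-or-large i       | yes stable = inj₁ stable
    chain-stable-or-large zero    | no grows   =
      inj₂ (≤-trans (≤-reflexive (cong (2 *_) (sym (gcd-zeroʳ e)))) (chain-doubles 0 grows))
    chain-stable-or-large (suc i) | no grows with chain-stable-or-large i
    ... | inj₁ stable = ⊥-elim (grows (chain-stable-step i stable))
    ... | inj₂ large  = inj₂ (≤-trans (*-monoʳ-≤ 2 large) (chain-doubles (suc i) grows))

    ∣^∧≤2^⇒∣^ : ∀ k j → e ∣ X ^ k → e ≤ 2 ^ j → e ∣ X ^ j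
    ∣^∧≤2^⇒∣^ k zero    _   e≤1 = subst (_∣ 1) (sym e≡1) ∣-refl
      where
      e≡1 : e ≡ 1
      e≡1 = ≤-antisym e≤1 (n≢0⇒n>0 (≢-nonZero⁻¹ e))
    ∣^∧≤2^⇒∣^ k (suc i) e∣Xᵏ e≤2ʲ = subst (_∣ X ^ suc i) chain[1+i]≡e (gcd[m,n]∣n e (X ^ suc i))
      where
      chain[1+i]≡e : chain (suc i) ≡ e
      chain[1+i]≡e with chain-stable-or-large i
      ... | inj₂ large  = ≤-antisym (∣⇒≤ (gcd[m,n]∣m e (X ^ suc i))) (≤-trans e≤2ʲ large)
      ... | inj₁ stable = begin
        chain (suc i)   ≡⟨ stable ⟩
        chain i         ≡⟨ sym (chain-stable i stable k) ⟩
        chain (k + i)   ≡⟨ ∣-antisym (gcd[m,n]∣m e (X ^ (k + i))) (gcd-greatest ∣-refl e∣Xᵏ⁺ⁱ) ⟩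
        e               ∎
        where
        open ≡-Reasoning
        e∣Xᵏ⁺ⁱ : e ∣ X ^ (k + i)
        e∣Xᵏ⁺ⁱ = ∣-trans e∣Xᵏ (subst (X ^ k ∣_) (sym (^-distribˡ-+-* X k i)) (m∣m*n (X ^ i)))

  open PowerGcd using (∣^∧≤2^⇒∣^)

  coprime-split : ∀ M x .{{_ : NonZero M}} → ∃₂ λ Q g → M ≡ Q * g × Coprime Q x × g ∣ x ^ M
  coprime-split M x with gcd[m,n]∣m M (x ^ M)
  ... | divides Q M≡Q*g = Q , g , M≡Q*g , Q⊥x , gcd[m,n]∣n M (x ^ M)
    where
    g = gcd M (x ^ M)
    instance
      g-nonZero : NonZero g
      g-nonZero = gcd-nonZeroˡ M (x ^ M)
    -- Since gcd(M, xᴹ⁺¹) ≤ M < 2ᴹ, it already divides xᴹ; hence Q keeps no factor of x.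
    saturated : gcd M (x ^ suc M) ∣ g
    saturated = gcd-greatest (gcd[m,n]∣m M (x ^ suc M))
      (∣^∧≤2^⇒∣^ (gcd M (x ^ suc M)) x {{gcd-nonZeroˡ M (x ^ suc M)}} (suc M) M (gcd[m,n]∣n M (x ^ suc M))
        (≤-trans (∣⇒≤ (gcd[m,n]∣m M (x ^ suc M))) (<⇒≤ (n<2^n M))))
    Q⊥x : Coprime Q x
    Q⊥x {i} (i∣Q , i∣x) =
      ∣1⇒≡1 (*-cancelʳ-∣ g (subst (i * g ∣_) (sym (*-identityˡ g)) (∣-trans i*g∣ saturated)))
      where
      i*g∣ : i * g ∣ gcd M (x ^ suc M)
      i*g∣ = gcd-greatest (subst (i * g ∣_) (sym M≡Q*g) (*-monoˡ-∣ g i∣Q)) (*-pres-∣ i∣x (gcd[m,n]∣n M (x ^ M)))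

  %≡%⇒∣∸ : ∀ m n L .{{_ : NonZero L}} → m % L ≡ n % L → L ∣ n ∸ m
  %≡%⇒∣∸ m n L eq = divides (n / L ∸ m / L) (begin
    n ∸ m                                      ≡⟨ cong₂ _∸_ (m≡m%n+[m/n]*n n L) (m≡m%n+[m/n]*n m L) ⟩
    (n % L + n / L * L) ∸ (m % L + m / L * L)  ≡⟨ cong (λ v → (n % L + n / L * L) ∸ (v + m / L * L)) eq ⟩
    (n % L + n / L * L) ∸ (n % L + m / L * L)  ≡⟨ [m+n]∸[m+o]≡n∸o (n % L) _ _ ⟩
    n / L * L ∸ m / L * L                      ≡⟨ sym (*-distribʳ-∸ L (n / L) (m / L)) ⟩
    (n / L ∸ m / L) * L                        ∎)
    where open ≡-Reasoning

  x^T≡1-mod-L : ∀ L x .{{_ : NonZero L}} .{{_ : NonZero x}} → Coprime L x →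
    ∃₂ λ T z → 1 ≤ T × x ^ T ≡ suc (L * z)
  x^T≡1-mod-L L x L⊥x with pigeonhole (n<1+n L) (λ i → fromℕ< (m%n<n (x ^ toℕ i) L))
  ... | i , j , i<j , same-residue = T , z , m<n⇒0<n∸m i<j , xᵀ≡1+Lz
    where
    a = toℕ i
    T = toℕ j ∸ a
    residues : x ^ a % L ≡ x ^ toℕ j % L
    residues = trans (sym (toℕ-fromℕ< (m%n<n (x ^ a) L)))
                 (trans (cong toℕ same-residue) (toℕ-fromℕ< (m%n<n (x ^ toℕ j) L)))
    xʲ≡xᵃ*xᵀ : x ^ toℕ j ≡ x ^ a * x ^ T
    xʲ≡xᵃ*xᵀ = trans (cong (x ^_) (sym (m+[n∸m]≡n (<⇒≤ i<j)))) (^-distribˡ-+-* x a T)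
    L∣xᵃ*[xᵀ-1] : L ∣ x ^ a * (x ^ T ∸ 1)
    L∣xᵃ*[xᵀ-1] = subst (L ∣_)
      (trans (cong₂ _∸_ xʲ≡xᵃ*xᵀ (sym (*-identityʳ (x ^ a)))) (sym (*-distribˡ-∸ (x ^ a) (x ^ T) 1)))
      (%≡%⇒∣∸ (x ^ a) (x ^ toℕ j) L residues)
    L∣xᵀ-1 : L ∣ x ^ T ∸ 1
    L∣xᵀ-1 = coprime-divisor (coprime-^ʳ a L⊥x) L∣xᵃ*[xᵀ-1]
    z = quotient L∣xᵀ-1
    xᵀ≡1+Lz : x ^ T ≡ suc (L * z)
    xᵀ≡1+Lz = begin
      x ^ T             ≡⟨ sym (m+[n∸m]≡n (m^n>0 x T)) ⟩
      suc (x ^ T ∸ 1)   ≡⟨ cong suc (m∣n⇒n≡m*quotient L∣xᵀ-1) ⟩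
      suc (L * z)       ∎
      where open ≡-Reasoning

  repunit : ℕ → ℕ → ℕ
  repunit y zero    = 0
  repunit y (suc n) = 1 + y * repunit y n

  [1+z]^n≡1+z*repunit : ∀ z n → suc z ^ n ≡ suc (z * repunit (suc z) n)
  [1+z]^n≡1+z*repunit z zero    = cong suc (sym (*-zeroʳ z))
  [1+z]^n≡1+z*repunit z (suc n) =
    trans (cong (suc z *_) ([1+z]^n≡1+z*repunit z n)) (expand z (repunit (suc z) n))
    where
    expand : ∀ z r → (1 + z) * (1 + z * r) ≡ 1 + z * (1 + (1 + z) * r)
    expand = solve-∀

  repunit-swap : ∀ w A T N → suc w ^ T ≡ suc A ^ N → w * repunit (suc w) T ≡ A * repunit (suc A) N
  repunit-swap w A T N eq =
    suc-injective (trans (sym ([1+z]^n≡1+z*repunit w T)) (trans eq ([1+z]^n≡1+z*repunit A N)))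

  repunit-+ : ∀ y m n → repunit y (m + n) ≡ repunit y m + y ^ m * repunit y n
  repunit-+ y zero    n = sym (+-identityʳ (repunit y n))
  repunit-+ y (suc m) n =
    trans (cong (λ v → 1 + y * v) (repunit-+ y m n)) (expand y (repunit y m) (y ^ m) (repunit y n))
    where
    expand : ∀ y a p b → 1 + y * (a + p * b) ≡ (1 + y * a) + (y * p) * b
    expand = solve-∀

  repunit-* : ∀ y a b → repunit y (a * b) ≡ repunit y a * repunit (y ^ a) b
  repunit-* y a zero    = trans (cong (repunit y) (*-zeroʳ a)) (sym (*-zeroʳ (repunit y a)))
  repunit-* y a (suc b) = begin
    repunit y (a * suc b)                                     ≡⟨ cong (repunit y) (*-suc a b) ⟩
    repunit y (a + a * b)                                     ≡⟨ repunit-+ y a (a * b) ⟩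
    repunit y a + y ^ a * repunit y (a * b)                   ≡⟨ cong (λ v → repunit y a + y ^ a * v) (repunit-* y a b) ⟩
    repunit y a + y ^ a * (repunit y a * repunit (y ^ a) b)   ≡⟨ factor (repunit y a) (y ^ a) (repunit (y ^ a) b) ⟩
    repunit y a * (1 + y ^ a * repunit (y ^ a) b)             ∎
    where
    open ≡-Reasoning
    factor : ∀ s p t → s + p * (s * t) ≡ s * (1 + p * t)
    factor = solve-∀

  repunit[1+D,n]≡n-mod-D : ∀ D n → ∃ λ c → repunit (suc D) n ≡ n + D * c
  repunit[1+D,n]≡n-mod-D D zero = 0 , sym (*-zeroʳ D)
  repunit[1+D,n]≡n-mod-D D (suc n) with repunit[1+D,n]≡n-mod-D D n
  ... | c , eq = c + (n + D * c) , trans (cong (λ v → 1 + suc D * v) eq) (expand D n c)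
    where
    expand : ∀ D n c → 1 + (1 + D) * (n + D * c) ≡ (1 + n) + D * (c + (n + D * c))
    expand = solve-∀

  repunit-suc-coprime : ∀ {x y} n → x ∣ y → Coprime (repunit y (suc n)) x
  repunit-suc-coprime {x} {y} n (divides q y≡q*x) =
    subst (λ v → Coprime (suc v) x) (sym y*R≡x*[q*R]) (coprime-1+* x (q * repunit y n))
    where
    y*R≡x*[q*R] : y * repunit y n ≡ x * (q * repunit y n)
    y*R≡x*[q*R] = trans (cong (_* repunit y n) y≡q*x) (rearrange q x (repunit y n))
      where
      rearrange : ∀ q x r → q * x * r ≡ x * (q * r)
      rearrange = solve-∀

  module LiftingTheExponent (Q : ℕ) .{{_ : NonZero Q}} where

    gcd[n,Q]≡1⇒repunit⊥Q : ∀ z n → gcd n Q ≡ 1 → Coprime (repunit (suc (Q * Q * z)) n) Q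
    gcd[n,Q]≡1⇒repunit⊥Q z n n⊥Q {i} (i∣S , i∣Q) with repunit[1+D,n]≡n-mod-D (Q * Q * z) n
    ... | c , S≡n+Dc = ∣1⇒≡1 (subst (i ∣_) n⊥Q (gcd-greatest i∣n i∣Q))
      where
      i∣D*c : i ∣ Q * Q * z * c
      i∣D*c = ∣m⇒∣m*n c (∣m⇒∣m*n z (∣m⇒∣m*n Q i∣Q))
      i∣n : i ∣ n
      i∣n = ∣m+n∣m⇒∣n (subst (i ∣_) (trans S≡n+Dc (+-comm n (Q * Q * z * c))) i∣S) i∣D*c

    -- Working with y ≡ 1 (mod Q²) rather than mod Q is what makes the cofactor of a in
    -- repunit y a congruent to 1 mod Q: one factor Q is used up to absorb a ∣ Q.
    repunit-split : ∀ z a n′ e → Q ≡ e * a → ∃ λ k →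
      repunit (suc (Q * Q * z)) (a * n′)
        ≡ suc (Q * k) * (a * repunit (suc (Q * Q * (z * repunit (suc (Q * Q * z)) a))) n′)
    repunit-split z a n′ e Q≡e*a with repunit[1+D,n]≡n-mod-D (Q * Q * z) a
    ... | c , Sₐ≡a+Dc = e * z * c , (begin
      repunit y (a * n′)         ≡⟨ repunit-* y a n′ ⟩
      Sₐ * repunit (y ^ a) n′    ≡⟨ cong₂ (λ u v → u * repunit v n′) Sₐ≡a*U yᵃ≡1+Q²zSₐ ⟩
      a * U * S′                 ≡⟨ swap a U S′ ⟩
      U * (a * S′)               ∎)
      where
      open ≡-Reasoning
      y = suc (Q * Q * z)
      Sₐ = repunit y a
      U = suc (Q * (e * z * c))
      S′ = repunit (suc (Q * Q * (z * Sₐ))) n′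
      Sₐ≡a*U : Sₐ ≡ a * U
      Sₐ≡a*U = begin
        Sₐ                      ≡⟨ Sₐ≡a+Dc ⟩
        a + Q * Q * z * c       ≡⟨ cong (λ v → a + Q * v * z * c) Q≡e*a ⟩
        a + Q * (e * a) * z * c ≡⟨ factor a Q e z c ⟩
        a * U                   ∎
        where
        factor : ∀ a Q e z c → a + Q * (e * a) * z * c ≡ a * (1 + Q * (e * z * c))
        factor = solve-∀
      yᵃ≡1+Q²zSₐ : y ^ a ≡ suc (Q * Q * (z * Sₐ))
      yᵃ≡1+Q²zSₐ = trans ([1+z]^n≡1+z*repunit (Q * Q * z) a) (cong suc (*-assoc (Q * Q) z Sₐ))
      swap : ∀ a u s → a * u * s ≡ u * (a * s)
      swap = solve-∀

    -- Strong induction on n: for a = gcd(n, Q) > 1 and n = a n′, repunit-split reduces the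
    -- claim for n to the claim for n′.
    gcd[Q^j,repunit]∣n : ∀ j z n → gcd (Q ^ j) (repunit (suc (Q * Q * z)) n) ∣ n
    gcd[Q^j,repunit]∣n j z n = go n (<-wellFounded n) z
      where
      go : ∀ n → Acc _<_ n → ∀ z → gcd (Q ^ j) (repunit (suc (Q * Q * z)) n) ∣ n
      go zero _ z = _ ∣0
      go n@(suc _) (acc rec) z with gcd n Q ≟ 1
      ... | yes n⊥Q = subst (_∣ n) (sym G≡1) (1∣ n)
        where
        G≡1 : gcd (Q ^ j) (repunit (suc (Q * Q * z)) n) ≡ 1
        G≡1 = coprime-^ʳ j (gcd[n,Q]≡1⇒repunit⊥Q z n n⊥Q) (gcd[m,n]∣n (Q ^ j) _ , gcd[m,n]∣m (Q ^ j) _)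
      ... | no n⊥̸Q with gcd[m,n]∣m n Q | gcd[m,n]∣n n Q
      ...   | divides n′ n≡n′*a | divides e Q≡e*a with repunit-split z (gcd n Q) n′ e Q≡e*a
      ...     | k , S≡U*[a*S′] = subst (G ∣_) a*n′≡n G∣a*n′
        where
        a = gcd n Q
        y = suc (Q * Q * z)
        G = gcd (Q ^ j) (repunit y n)
        S′ = repunit (suc (Q * Q * (z * repunit y a))) n′
        a*n′≡n : a * n′ ≡ n
        a*n′≡n = trans (*-comm a n′) (sym n≡n′*a)
        instance
          n′-nonZero : NonZero n′
          n′-nonZero = ≢-nonZero λ { refl → ≢-nonZero⁻¹ n n≡n′*a }
        n′<n : n′ < n
        n′<n = subst (n′ <_) (sym n≡n′*a)
          (m<m*n n′ a (≤∧≢⇒< (n≢0⇒n>0 (gcd[m,n]≢0 n Q (inj₂ (≢-nonZero⁻¹ Q)))) (λ eq → n⊥̸Q (sym eq))))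
        G∣U*[a*S′] : G ∣ suc (Q * k) * (a * S′)
        G∣U*[a*S′] = subst (G ∣_) (trans (cong (repunit y) (sym a*n′≡n)) S≡U*[a*S′])
          (gcd[m,n]∣n (Q ^ j) (repunit y n))
        G∣a*S′ : G ∣ a * S′
        G∣a*S′ = coprime-divisor (coprime-∣ˡ (gcd[m,n]∣m (Q ^ j) (repunit y n))
          (Coprimality.sym (coprime-^ʳ j (coprime-1+* Q k)))) G∣U*[a*S′]
        G∣a*n′ : G ∣ a * n′
        G∣a*n′ = ∣-trans (subst (G ∣_) (sym (c*gcd[m,n]≡gcd[cm,cn] a (Q ^ j) S′))
                            (gcd-greatest (∣n⇒∣m*n a (gcd[m,n]∣m (Q ^ j) (repunit y n))) G∣a*S′))
                          (*-monoʳ-∣ a (go n′ (rec n′<n) (z * repunit y a)))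

  gcd[[Q*g]^N,b^N∸1]∣Q²z*N : ∀ b Q g k T z N .{{_ : NonZero b}} .{{_ : NonZero Q}} →
    g ∣ b ^ k → 1 ≤ T → b ^ T ≡ suc (Q * Q * z) → 1 ≤ N →
    gcd ((Q * g) ^ N) (b ^ N ∸ 1) ∣ Q * Q * z * N
  gcd[[Q*g]^N,b^N∸1]∣Q²z*N b Q g k T z N@(suc N-1) g∣bᵏ T≥1 bᵀ≡1+A _ = begin
    gcd K w         ∣⟨ gcd-greatest (gcd[m,n]∣m K w) (∣-trans (gcd[m,n]∣n K w) w∣A*S) ⟩
    gcd K (A * S)   ∣⟨ gcd[m,n*o]∣n*gcd[m,o] K A S ⟩
    A * gcd K S     ∣⟨ *-monoʳ-∣ A G∣N ⟩
    A * N           ∎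
    where
    open ∣-Reasoning
    A = Q * Q * z
    K = (Q * g) ^ N
    w = b ^ N ∸ 1
    S = repunit (suc A) N
    bᴺ≡1+w : b ^ N ≡ suc w
    bᴺ≡1+w = sym (m+[n∸m]≡n (m^n>0 b N))
    w∣A*S : w ∣ A * S
    w∣A*S = divides (repunit (suc w) T) (trans (sym (repunit-swap w A T N [1+w]ᵀ≡[1+A]ᴺ)) (*-comm w _))
      where
      [1+w]ᵀ≡[1+A]ᴺ : suc w ^ T ≡ suc A ^ N
      [1+w]ᵀ≡[1+A]ᴺ = subst₂ (λ u v → u ^ T ≡ v ^ N) bᴺ≡1+w bᵀ≡1+A
        (trans (^-*-assoc b N T) (trans (cong (b ^_) (*-comm N T)) (sym (^-*-assoc b T N))))
    b∣1+A : b ∣ suc A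
    b∣1+A = subst (b ∣_) bᵀ≡1+A (subst (λ t → b ∣ b ^ t) (m+[n∸m]≡n T≥1) (m∣m*n (b ^ (T ∸ 1))))
    G = gcd K S
    S⊥g : Coprime S g
    S⊥g = coprime-∣ʳ g∣bᵏ (coprime-^ʳ k (repunit-suc-coprime N-1 b∣1+A))
    G∣Qᴺ : G ∣ Q ^ N
    G∣Qᴺ = coprime-divisor (coprime-∣ˡ (gcd[m,n]∣n K S) (coprime-^ʳ N S⊥g))
      (subst (G ∣_) (trans (^-distribʳ-* Q g N) (*-comm (Q ^ N) (g ^ N))) (gcd[m,n]∣m K S))
    G∣N : G ∣ N
    G∣N = ∣-trans (gcd-greatest G∣Qᴺ (gcd[m,n]∣n K S)) (LiftingTheExponent.gcd[Q^j,repunit]∣n Q N z N)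

  gcd[M^N,b^N∸1]-linear : ∀ M b .{{_ : NonZero M}} .{{_ : NonZero b}} → 2 ≤ b →
    ∃ λ A → NonZero A × (∀ N → 1 ≤ N → gcd (M ^ N) (b ^ N ∸ 1) ∣ A * N)
  gcd[M^N,b^N∸1]-linear M b 2≤b with coprime-split M b
  ... | Q , g , M≡Q*g , Q⊥b , g∣bᴹ = linear (x^T≡1-mod-L (Q * Q) b {{m*n≢0 Q Q}} Q²⊥b)
    where
    instance
      Q-nonZero : NonZero Q
      Q-nonZero = ≢-nonZero λ Q≡0 → ≢-nonZero⁻¹ M (trans M≡Q*g (cong (_* g) Q≡0))
    Q²⊥b : Coprime (Q * Q) b
    Q²⊥b = Coprimality.sym (coprime-*ʳ (Coprimality.sym Q⊥b) (Coprimality.sym Q⊥b))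
    linear : (∃₂ λ T z → 1 ≤ T × b ^ T ≡ suc (Q * Q * z)) →
      ∃ λ A → NonZero A × (∀ N → 1 ≤ N → gcd (M ^ N) (b ^ N ∸ 1) ∣ A * N)
    linear (T , z , T≥1 , bᵀ≡1+A) = Q * Q * z , A-nonZero , bound
      where
      A-nonZero : NonZero (Q * Q * z)
      A-nonZero = ≢-nonZero λ A≡0 → <-irrefl refl (begin-strict
        1          <⟨ 2≤b ⟩
        b          ≡⟨ sym (*-identityʳ b) ⟩
        b ^ 1      ≤⟨ ^-monoʳ-≤ b T≥1 ⟩
        b ^ T      ≡⟨ trans bᵀ≡1+A (cong suc A≡0) ⟩
        1          ∎)
        where open ≤-Reasoning
      bound : ∀ N → 1 ≤ N → gcd (M ^ N) (b ^ N ∸ 1) ∣ Q * Q * z * N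
      bound N N≥1 = subst (λ v → gcd (v ^ N) (b ^ N ∸ 1) ∣ Q * Q * z * N) (sym M≡Q*g)
        (gcd[[Q*g]^N,b^N∸1]∣Q²z*N b Q g M T z N g∣bᴹ T≥1 bᵀ≡1+A N≥1)

  n*n≤2^n : ∀ n → 4 ≤ n → n * n ≤ 2 ^ n
  n*n≤2^n n 4≤n = subst (λ v → v * v ≤ 2 ^ v) (m+[n∸m]≡n 4≤n) (go (n ∸ 4))
    where
    go : ∀ n → (4 + n) * (4 + n) ≤ 2 ^ (4 + n)
    go zero    = ≤-refl
    go (suc n) = ≤-trans (≤-trans (m≤m+n ((5 + n) * (5 + n)) (7 + 6 * n + n * n)) (≤-reflexive (expand n)))
                          (*-monoʳ-≤ 2 (go n))
      where
      expand : ∀ n → (5 + n) * (5 + n) + (7 + 6 * n + n * n) ≡ 2 * ((4 + n) * (4 + n))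
      expand = solve-∀

  C*[ℓ+k]≤2^k : ∀ C ℓ → ∃ λ k₀ → ∀ k → k₀ ≤ k → C * (ℓ + k) ≤ 2 ^ k
  C*[ℓ+k]≤2^k C ℓ = C * (ℓ + 1) + 4 , bound
    where
    bound : ∀ k → C * (ℓ + 1) + 4 ≤ k → C * (ℓ + k) ≤ 2 ^ k
    bound k k₀≤k = begin
      C * (ℓ + k)         ≤⟨ *-monoʳ-≤ C (+-monoˡ-≤ k (m≤m*n ℓ k)) ⟩
      C * (ℓ * k + k)     ≡⟨ regroup C ℓ k ⟩
      C * (ℓ + 1) * k     ≤⟨ *-monoˡ-≤ k (≤-trans (m≤m+n _ 4) k₀≤k) ⟩
      k * k               ≤⟨ n*n≤2^n k 4≤k ⟩
      2 ^ k               ∎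
      where
      open ≤-Reasoning
      4≤k : 4 ≤ k
      4≤k = ≤-trans (m≤n+m 4 _) k₀≤k
      instance
        k-nonZero : NonZero k
        k-nonZero = >-nonZero (≤-trans (s≤s z≤n) 4≤k)
      regroup : ∀ C ℓ k → C * (ℓ * k + k) ≡ C * (ℓ + 1) * k
      regroup = solve-∀

  ^[ℓ+k]∣*∧gcd∣^k⇒^ℓ∣ : ∀ M ℓ k t P .{{_ : NonZero M}} →
    M ^ (ℓ + k) ∣ t * P → gcd (M ^ (ℓ + k)) P ∣ M ^ k → M ^ ℓ ∣ t
  ^[ℓ+k]∣*∧gcd∣^k⇒^ℓ∣ M ℓ k t P K∣t*P e∣Mᵏ = *-cancelʳ-∣ (M ^ k) {{m^n≢0 M k}} (begin
    M ^ ℓ * M ^ k                   ≡⟨ sym (^-distribˡ-+-* M ℓ k) ⟩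
    M ^ (ℓ + k)                     ∣⟨ gcd-greatest (n∣m*n t) K∣t*P ⟩
    gcd (t * M ^ (ℓ + k)) (t * P)   ≡⟨ sym (c*gcd[m,n]≡gcd[cm,cn] t (M ^ (ℓ + k)) P) ⟩
    t * gcd (M ^ (ℓ + k)) P         ∣⟨ *-monoʳ-∣ t e∣Mᵏ ⟩
    t * M ^ k                       ∎)
    where open ∣-Reasoning

  M^ℓ∣t-eventually : ∀ M b m ℓ .{{_ : NonZero M}} .{{_ : NonZero b}} .{{_ : NonZero m}} → 2 ≤ b →
    ∃ λ N₀ → ∀ N → 1 ≤ N → N₀ ≤ N → ∀ t → M ^ N ∣ t * (m * (b ^ N ∸ 1)) → M ^ ℓ ∣ t
  M^ℓ∣t-eventually M b m ℓ 2≤b = eventually (gcd[M^N,b^N∸1]-linear M b 2≤b)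
    where
    Conclusion : ℕ → Set
    Conclusion N = ∀ t → M ^ N ∣ t * (m * (b ^ N ∸ 1)) → M ^ ℓ ∣ t
    eventually : (∃ λ A → NonZero A × (∀ N → 1 ≤ N → gcd (M ^ N) (b ^ N ∸ 1) ∣ A * N)) →
      ∃ λ N₀ → ∀ N → 1 ≤ N → N₀ ≤ N → Conclusion N
    eventually (A , A-nonZero , linear) = ℓ + k₀ , beyond
      where
      k₀ = proj₁ (C*[ℓ+k]≤2^k (m * A) ℓ)
      conclusion : ∀ k → k₀ ≤ k → 1 ≤ ℓ + k → Conclusion (ℓ + k)
      conclusion k k₀≤k N≥1 t Mᴺ∣t*P = ^[ℓ+k]∣*∧gcd∣^k⇒^ℓ∣ M ℓ k t P Mᴺ∣t*P e∣Mᵏ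
        where
        N = ℓ + k
        P = m * (b ^ N ∸ 1)
        e = gcd (M ^ N) P
        e∣m*A*N : e ∣ m * (A * N)
        e∣m*A*N = ∣-trans (gcd[m,n*o]∣n*gcd[m,o] (M ^ N) m (b ^ N ∸ 1)) (*-monoʳ-∣ m (linear N N≥1))
        bound-nonZero : NonZero (m * (A * N))
        bound-nonZero = m*n≢0 m (A * N) {{it}} {{m*n≢0 A N {{A-nonZero}} {{>-nonZero N≥1}}}}
        e≤2ᵏ : e ≤ 2 ^ k
        e≤2ᵏ = ≤-trans (∣⇒≤ {{bound-nonZero}} e∣m*A*N)
                       (≤-trans (≤-reflexive (sym (*-assoc m A N))) (proj₂ (C*[ℓ+k]≤2^k (m * A) ℓ) k k₀≤k))
        e∣Mᵏ : e ∣ M ^ k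
        e∣Mᵏ = ∣^∧≤2^⇒∣^ e M {{gcd-nonZeroˡ (M ^ N) P {{m^n≢0 M N}}}} N k (gcd[m,n]∣m (M ^ N) P) e≤2ᵏ

      beyond : ∀ N → 1 ≤ N → ℓ + k₀ ≤ N → Conclusion N
      beyond N N≥1 ℓ+k₀≤N = subst Conclusion ℓ+k≡N (conclusion k k₀≤k (subst (1 ≤_) (sym ℓ+k≡N) N≥1))
        where
        k = N ∸ ℓ
        ℓ+k≡N : ℓ + k ≡ N
        ℓ+k≡N = m+[n∸m]≡n (≤-trans (m≤m+n ℓ k₀) ℓ+k₀≤N)
        k₀≤k : k₀ ≤ k
        k₀≤k = subst (_≤ k) (m+n∸m≡n ℓ k₀) (∸-monoˡ-≤ ℓ ℓ+k₀≤N)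

module AffineMaps where

  open import Defs
  open import Data.Nat as ℕ using (ℕ; zero; suc; NonZero)
  import Data.Nat.Properties as ℕP
  open import Data.Nat.Divisibility using () renaming (_∣_ to _∣ℕ_)
  open import Data.Integer as ℤ using (ℤ; +_)
  import Data.Integer.Properties as ℤP
  import Data.Integer.Divisibility.Signed as ℤD
  open import Data.Integer.Tactic.RingSolver using (solve-∀)
  open import Data.Rational using (ℚ; _/_; _+_; _*_; _-_; 1ℚ; ↥_; ↧_; ↧ₙ_; toℚᵘ)
  open import Data.Rational.Properties
    using (toℚᵘ-injective; toℚᵘ-fromℚᵘ; toℚᵘ-homo-+; toℚᵘ-homo-*; toℚᵘ-cong; ↥p/↧p≡p; *-identityˡ; *-identityʳ)
  import Data.Rational.Unnormalised as ℚᵘ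
  import Data.Rational.Unnormalised.Properties as ℚᵘP
  open import Data.Rational.Solver using (module +-*-Solver)
  open +-*-Solver using (solve; _:+_; _:*_; _:-_; _:=_; con)
  open import Relation.Binary.PropositionalEquality
  open ≡-Reasoning

  ι : ℤ → ℚ
  ι z = z / 1

  toℚᵘ-ι : ∀ z → toℚᵘ (ι z) ℚᵘ.≃ ℚᵘ.mkℚᵘ z 0
  toℚᵘ-ι z = toℚᵘ-fromℚᵘ (ℚᵘ.mkℚᵘ z 0)

  ι-* : ∀ a b → ι (a ℤ.* b) ≡ ι a * ι b
  ι-* a b = toℚᵘ-injective (ℚᵘP.≃-trans (toℚᵘ-ι (a ℤ.* b))
    (ℚᵘP.≃-sym (ℚᵘP.≃-trans (toℚᵘ-homo-* (ι a) (ι b)) (ℚᵘP.*-cong (toℚᵘ-ι a) (toℚᵘ-ι b)))))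

  ι-+ : ∀ a b → ι (a ℤ.+ b) ≡ ι a + ι b
  ι-+ a b = toℚᵘ-injective (ℚᵘP.≃-trans (toℚᵘ-ι (a ℤ.+ b)) (ℚᵘP.≃-trans (ℚᵘ.*≡* (cross a b))
    (ℚᵘP.≃-sym (ℚᵘP.≃-trans (toℚᵘ-homo-+ (ι a) (ι b)) (ℚᵘP.+-cong (toℚᵘ-ι a) (toℚᵘ-ι b))))))
    where
    cross : ∀ a b → (a ℤ.+ b) ℤ.* + 1 ≡ (a ℤ.* + 1 ℤ.+ b ℤ.* + 1) ℤ.* + 1
    cross = solve-∀

  ι-injective : ∀ {a b} → ι a ≡ ι b → a ≡ b
  ι-injective {a} {b} eq with ℚᵘP.≃-trans (ℚᵘP.≃-sym (toℚᵘ-ι a)) (ℚᵘP.≃-trans (toℚᵘ-cong eq) (toℚᵘ-ι b))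
  ... | ℚᵘ.*≡* e = trans (sym (ℤP.*-identityʳ a)) (trans e (ℤP.*-identityʳ b))

  ι-pos-* : ∀ m n → ι (+ (m ℕ.* n)) ≡ ι (+ m) * ι (+ n)
  ι-pos-* m n = trans (cong ι (ℤP.pos-* m n)) (ι-* (+ m) (+ n))

  ι-*³ : ∀ a b c d → ι (a ℤ.* b ℤ.* c ℤ.* d) ≡ ι a * ι b * ι c * ι d
  ι-*³ a b c d = begin
    ι (a ℤ.* b ℤ.* c ℤ.* d)   ≡⟨ ι-* (a ℤ.* b ℤ.* c) d ⟩
    ι (a ℤ.* b ℤ.* c) * ι d   ≡⟨ cong (_* ι d) (ι-* (a ℤ.* b) c) ⟩
    ι (a ℤ.* b) * ι c * ι d   ≡⟨ cong (λ v → v * ι c * ι d) (ι-* a b) ⟩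
    ι a * ι b * ι c * ι d     ∎

  frac-*-ι : ∀ n d .{{_ : NonZero d}} → frac n d * ι (+ d) ≡ ι n
  frac-*-ι n (suc d) = toℚᵘ-injective (ℚᵘP.≃-trans (toℚᵘ-homo-* (frac n (suc d)) (ι (+ suc d)))
    (ℚᵘP.≃-trans (ℚᵘP.*-cong (toℚᵘ-fromℚᵘ (ℚᵘ.mkℚᵘ n d)) (toℚᵘ-ι (+ suc d)))
    (ℚᵘP.≃-trans (ℚᵘ.*≡* (trans (ℤP.*-identityʳ _) (cong (λ v → n ℤ.* + suc v) (sym (ℕP.*-identityʳ d)))))
      (ℚᵘP.≃-sym (toℚᵘ-ι n)))))

  *-ι↧≡ι↥ : ∀ x → x * ι (↧ x) ≡ ι (↥ x)
  *-ι↧≡ι↥ x = trans (cong (_* ι (↧ x)) (sym (↥p/↧p≡p x))) (frac-*-ι (↥ x) (↧ₙ x))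

  *-cancelʳ-ι : ∀ d .{{_ : NonZero d}} {x y : ℚ} → x * ι (+ d) ≡ y * ι (+ d) → x ≡ y
  *-cancelʳ-ι d {x} {y} eq = begin
    x                           ≡⟨ sym (*-identityʳ x) ⟩
    x * 1ℚ                      ≡⟨ cong (x *_) (sym d⁻¹*d) ⟩
    x * (d⁻¹ * ι (+ d))         ≡⟨ reassoc x ⟩
    (x * ι (+ d)) * d⁻¹         ≡⟨ cong (_* d⁻¹) eq ⟩
    (y * ι (+ d)) * d⁻¹         ≡⟨ sym (reassoc y) ⟩
    y * (d⁻¹ * ι (+ d))         ≡⟨ cong (y *_) d⁻¹*d ⟩
    y * 1ℚ                      ≡⟨ *-identityʳ y ⟩
    y                           ∎
    where
    d⁻¹ = frac (+ 1) d
    d⁻¹*d : d⁻¹ * ι (+ d) ≡ 1ℚ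
    d⁻¹*d = frac-*-ι (+ 1) d
    reassoc : ∀ z → z * (d⁻¹ * ι (+ d)) ≡ (z * ι (+ d)) * d⁻¹
    reassoc z = solve 3 (λ z a b → z :* (a :* b) := (z :* b) :* a) refl z d⁻¹ (ι (+ d))

  affine-fixpt : ∀ b r s → 2 ℕ.≤ b → 1 ℕ.≤ s → affine b r s (fixpt b r s) ≡ fixpt b r s
  affine-fixpt b@(suc b-1@(suc _)) r s@(suc _) (ℕ.s≤s (ℕ.s≤s _)) (ℕ.s≤s _) =
    *-cancelʳ-ι (b ℕ.* (b-1 ℕ.* s)) (begin
      (u * F + c) * ι (+ (b ℕ.* (b-1 ℕ.* s)))      ≡⟨ cong ((u * F + c) *_) ι-K ⟩
      (u * F + c) * (B * (C * S))                  ≡⟨ regroupₗ u F c B C S ⟩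
      (u * B) * (F * (C * S)) + (c * S) * (B * C)
        ≡⟨ cong₂ (λ p q → p * (F * (C * S)) + q * (B * C)) (frac-*-ι (+ 1) b) (frac-*-ι r s) ⟩
      1ℚ * (F * (C * S)) + R * (B * C)             ≡⟨ cong (λ p → 1ℚ * p + R * (B * C)) F*C*S ⟩
      1ℚ * (B * R) + R * (B * C)                   ≡⟨ regroupₘ 1ℚ B R C ⟩
      (1ℚ + C) * (B * R)                           ≡⟨ cong (_* (B * R)) (sym (ι-+ (+ 1) (+ b-1))) ⟩
      B * (B * R)                                  ≡⟨ cong (B *_) (sym F*C*S) ⟩
      B * (F * (C * S))                            ≡⟨ regroupᵣ B F C S ⟩
      F * (B * (C * S))                            ≡⟨ cong (F *_) (sym ι-K) ⟩
      F * ι (+ (b ℕ.* (b-1 ℕ.* s)))                ∎)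
    where
    u = frac (+ 1) b
    c = frac r s
    F = fixpt b r s
    B = ι (+ b)
    C = ι (+ b-1)
    S = ι (+ s)
    R = ι r
    F*C*S : F * (C * S) ≡ B * R
    F*C*S = trans (cong (F *_) (sym (ι-pos-* b-1 s))) (trans (frac-*-ι (+ b ℤ.* r) (b-1 ℕ.* s)) (ι-* (+ b) r))
    ι-K : ι (+ (b ℕ.* (b-1 ℕ.* s))) ≡ B * (C * S)
    ι-K = trans (ι-pos-* b (b-1 ℕ.* s)) (cong (B *_) (ι-pos-* b-1 s))
    regroupₗ : ∀ u F c B C S → (u * F + c) * (B * (C * S)) ≡ (u * B) * (F * (C * S)) + (c * S) * (B * C)
    regroupₗ = solve 6 (λ u F c B C S →
      (u :* F :+ c) :* (B :* (C :* S)) := (u :* B) :* (F :* (C :* S)) :+ (c :* S) :* (B :* C)) refl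
    regroupₘ : ∀ e B R C → e * (B * R) + R * (B * C) ≡ (e + C) * (B * R)
    regroupₘ = solve 4 (λ e B R C → e :* (B :* R) :+ R :* (B :* C) := (e :+ C) :* (B :* R)) refl
    regroupᵣ : ∀ B F C S → B * (F * (C * S)) ≡ F * (B * (C * S))
    regroupᵣ = solve 4 (λ B F C S → B :* (F :* (C :* S)) := F :* (B :* (C :* S))) refl

  module _ (b : ℕ) .{{_ : NonZero b}} (r : ℤ) (s : ℕ) {F : ℚ} (fixed : affine b r s F ≡ F) where

    iter-affine : ∀ n x → (iter (affine b r s) n x - F) * ι (+ (b ℕ.^ n)) ≡ x - F
    iter-affine zero x = *-identityʳ (x - F)
    iter-affine (suc n) x = begin
      (u * y + c - F) * ι (+ (b ℕ.* b ℕ.^ n))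
        ≡⟨ cong₂ (λ p q → (u * y + c - p) * q) (sym fixed) (ι-pos-* b (b ℕ.^ n)) ⟩
      (u * y + c - (u * F + c)) * (ι (+ b) * bⁿ)   ≡⟨ regroup u y c F (ι (+ b)) bⁿ ⟩
      (u * ι (+ b)) * ((y - F) * bⁿ)               ≡⟨ cong₂ _*_ (frac-*-ι (+ 1) b) (iter-affine n x) ⟩
      1ℚ * (x - F)                                 ≡⟨ *-identityˡ (x - F) ⟩
      x - F                                        ∎
      where
      u = frac (+ 1) b
      c = frac r s
      y = iter (affine b r s) n x
      bⁿ = ι (+ (b ℕ.^ n))
      regroup : ∀ u y c F B P → (u * y + c - (u * F + c)) * (B * P) ≡ (u * B) * ((y - F) * P)
      regroup = solve 6 (λ u y c F B P →
        (u :* y :+ c :- (u :* F :+ c)) :* (B :* P) := (u :* B) :* ((y :- F) :* P)) refl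

  ι-pred : ∀ n → 1 ℕ.≤ n → ι (+ n) ≡ 1ℚ + ι (+ (n ℕ.∸ 1))
  ι-pred (suc n) _ = ι-+ (+ 1) (+ n)

  iter-affine-∘ : ∀ b₁ r₁ s₁ b₂ r₂ s₂ .{{_ : NonZero b₁}} .{{_ : NonZero b₂}} {F X : ℚ} →
    affine b₁ r₁ s₁ F ≡ F → affine b₂ r₂ s₂ X ≡ X → ∀ N →
    iter (affine b₂ r₂ s₂) N (iter (affine b₁ r₁ s₁) N X) * ι (+ (b₁ ℕ.^ N ℕ.* b₂ ℕ.^ N))
      ≡ X * ι (+ (b₁ ℕ.^ N ℕ.* b₂ ℕ.^ N)) + (F - X) * ι (+ (b₁ ℕ.^ N ℕ.∸ 1))
  iter-affine-∘ b₁ r₁ s₁ b₂ r₂ s₂ {F} {X} F-fixed X-fixed N = begin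
    R * K                                     ≡⟨ cong (R *_) K≡P₁*P₂ ⟩
    R * (P₁ * P₂)                             ≡⟨ split₁ R X P₁ P₂ ⟩
    X * (P₁ * P₂) + (R - X) * P₂ * P₁
      ≡⟨ cong (λ v → X * (P₁ * P₂) + v * P₁) (iter-affine b₂ r₂ s₂ X-fixed N Y) ⟩
    X * (P₁ * P₂) + (Y - X) * P₁              ≡⟨ split₂ X P₁ P₂ Y F ⟩
    X * (P₁ * P₂) + ((Y - F) * P₁ + (F - X) * P₁)
      ≡⟨ cong (λ v → X * (P₁ * P₂) + (v + (F - X) * P₁)) (iter-affine b₁ r₁ s₁ F-fixed N X) ⟩
    X * (P₁ * P₂) + ((X - F) + (F - X) * P₁)
      ≡⟨ cong (λ v → X * (P₁ * P₂) + ((X - F) + (F - X) * v)) (ι-pred (b₁ ℕ.^ N) (ℕP.m^n>0 b₁ N)) ⟩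
    X * (P₁ * P₂) + ((X - F) + (F - X) * (1ℚ + W)) ≡⟨ split₃ X P₁ P₂ F W ⟩
    X * (P₁ * P₂) + (F - X) * W               ≡⟨ cong (λ v → X * v + (F - X) * W) (sym K≡P₁*P₂) ⟩
    X * K + (F - X) * W                       ∎
    where
    Y = iter (affine b₁ r₁ s₁) N X
    R = iter (affine b₂ r₂ s₂) N Y
    K = ι (+ (b₁ ℕ.^ N ℕ.* b₂ ℕ.^ N))
    W = ι (+ (b₁ ℕ.^ N ℕ.∸ 1))
    P₁ = ι (+ (b₁ ℕ.^ N))
    P₂ = ι (+ (b₂ ℕ.^ N))
    K≡P₁*P₂ : K ≡ P₁ * P₂
    K≡P₁*P₂ = ι-pos-* (b₁ ℕ.^ N) (b₂ ℕ.^ N)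
    split₁ : ∀ R X P₁ P₂ → R * (P₁ * P₂) ≡ X * (P₁ * P₂) + (R - X) * P₂ * P₁
    split₁ = solve 4 (λ R X P₁ P₂ → R :* (P₁ :* P₂) := X :* (P₁ :* P₂) :+ (R :- X) :* P₂ :* P₁) refl
    split₂ : ∀ X P₁ P₂ Y F → X * (P₁ * P₂) + (Y - X) * P₁ ≡ X * (P₁ * P₂) + ((Y - F) * P₁ + (F - X) * P₁)
    split₂ = solve 5 (λ X P₁ P₂ Y F →
      X :* (P₁ :* P₂) :+ (Y :- X) :* P₁ := X :* (P₁ :* P₂) :+ ((Y :- F) :* P₁ :+ (F :- X) :* P₁)) refl
    split₃ : ∀ X P₁ P₂ F W → X * (P₁ * P₂) + ((X - F) + (F - X) * (1ℚ + W)) ≡ X * (P₁ * P₂) + (F - X) * W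
    split₃ = solve 5 (λ X P₁ P₂ F W →
      X :* (P₁ :* P₂) :+ ((X :- F) :+ (F :- X) :* (con 1ℚ :+ W)) := X :* (P₁ :* P₂) :+ (F :- X) :* W) refl

  ↧ₙ-divisibility : ∀ (R X D : ℚ) (k w : ℕ) → R * ι (+ k) ≡ X * ι (+ k) + D * ι (+ w) →
    k ∣ℕ ↧ₙ R ℕ.* (↧ₙ X ℕ.* ℤ.∣ ↥ D ∣ ℕ.* w)
  ↧ₙ-divisibility R X D k w eq = subst (k ∣ℕ_) abs-product (ℤD.∣⇒∣ᵤ (ℤD.divides Z product≡Z*k))
    where
    nR = ↥ R
    nX = ↥ X
    nD = ↥ D
    tR = ↧ R
    tX = ↧ X
    tD = ↧ D
    κ = ι (+ k)
    ω = ι (+ w)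
    cleared : nR ℤ.* + k ℤ.* tX ℤ.* tD ≡ nX ℤ.* + k ℤ.* tR ℤ.* tD ℤ.+ nD ℤ.* + w ℤ.* tR ℤ.* tX
    cleared = ι-injective (begin
      ι (nR ℤ.* + k ℤ.* tX ℤ.* tD)                ≡⟨ ι-*³ nR (+ k) tX tD ⟩
      ι nR * κ * ι tX * ι tD                      ≡⟨ cong (λ v → v * κ * ι tX * ι tD) (sym (*-ι↧≡ι↥ R)) ⟩
      R * ι tR * κ * ι tX * ι tD                  ≡⟨ regroupₗ R (ι tR) κ (ι tX) (ι tD) ⟩
      (R * κ) * (ι tR * ι tX * ι tD)              ≡⟨ cong (_* (ι tR * ι tX * ι tD)) eq ⟩
      (X * κ + D * ω) * (ι tR * ι tX * ι tD)      ≡⟨ regroupᵣ X κ D ω (ι tR) (ι tX) (ι tD) ⟩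
      X * ι tX * κ * ι tR * ι tD + D * ι tD * ω * ι tR * ι tX
        ≡⟨ cong₂ (λ p q → p * κ * ι tR * ι tD + q * ω * ι tR * ι tX) (*-ι↧≡ι↥ X) (*-ι↧≡ι↥ D) ⟩
      ι nX * κ * ι tR * ι tD + ι nD * ω * ι tR * ι tX
        ≡⟨ sym (cong₂ _+_ (ι-*³ nX (+ k) tR tD) (ι-*³ nD (+ w) tR tX)) ⟩
      ι (nX ℤ.* + k ℤ.* tR ℤ.* tD) + ι (nD ℤ.* + w ℤ.* tR ℤ.* tX)
        ≡⟨ sym (ι-+ (nX ℤ.* + k ℤ.* tR ℤ.* tD) (nD ℤ.* + w ℤ.* tR ℤ.* tX)) ⟩
      ι (nX ℤ.* + k ℤ.* tR ℤ.* tD ℤ.+ nD ℤ.* + w ℤ.* tR ℤ.* tX)   ∎)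
      where
      regroupₗ : ∀ R t κ x d → R * t * κ * x * d ≡ (R * κ) * (t * x * d)
      regroupₗ = solve 5 (λ R t κ x d → R :* t :* κ :* x :* d := (R :* κ) :* (t :* x :* d)) refl
      regroupᵣ : ∀ X κ D ω t x d → (X * κ + D * ω) * (t * x * d) ≡ X * x * κ * t * d + D * d * ω * t * x
      regroupᵣ = solve 7 (λ X κ D ω t x d →
        (X :* κ :+ D :* ω) :* (t :* x :* d) := X :* x :* κ :* t :* d :+ D :* d :* ω :* t :* x) refl
    Z = nR ℤ.* tX ℤ.* tD ℤ.- nX ℤ.* tR ℤ.* tD
    product≡Z*k : tR ℤ.* (tX ℤ.* nD ℤ.* + w) ≡ Z ℤ.* + k
    product≡Z*k = begin
      tR ℤ.* (tX ℤ.* nD ℤ.* + w)                              ≡⟨ isolate tR tX nD (+ w) nX (+ k) tD ⟩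
      (nX ℤ.* + k ℤ.* tR ℤ.* tD ℤ.+ nD ℤ.* + w ℤ.* tR ℤ.* tX) ℤ.- nX ℤ.* + k ℤ.* tR ℤ.* tD
        ≡⟨ cong (ℤ._- nX ℤ.* + k ℤ.* tR ℤ.* tD) (sym cleared) ⟩
      nR ℤ.* + k ℤ.* tX ℤ.* tD ℤ.- nX ℤ.* + k ℤ.* tR ℤ.* tD   ≡⟨ factor nR (+ k) tX tD nX tR ⟩
      Z ℤ.* + k                                                ∎
      where
      isolate : ∀ t x n w a k d →
        t ℤ.* (x ℤ.* n ℤ.* w) ≡ (a ℤ.* k ℤ.* t ℤ.* d ℤ.+ n ℤ.* w ℤ.* t ℤ.* x) ℤ.- a ℤ.* k ℤ.* t ℤ.* d
      isolate = solve-∀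
      factor : ∀ n k x d a t →
        n ℤ.* k ℤ.* x ℤ.* d ℤ.- a ℤ.* k ℤ.* t ℤ.* d ≡ (n ℤ.* x ℤ.* d ℤ.- a ℤ.* t ℤ.* d) ℤ.* k
      factor = solve-∀
    abs-product : ℤ.∣ tR ℤ.* (tX ℤ.* nD ℤ.* + w) ∣ ≡ ↧ₙ R ℕ.* (↧ₙ X ℕ.* ℤ.∣ nD ∣ ℕ.* w)
    abs-product = trans (ℤP.abs-* tR (tX ℤ.* nD ℤ.* + w))
      (cong (↧ₙ R ℕ.*_) (trans (ℤP.abs-* (tX ℤ.* nD) (+ w)) (cong (ℕ._* w) (ℤP.abs-* tX nD))))


open import Defs
open import Data.Nat using (ℕ; _≤_; _^_; _*_; _∸_; NonZero; >-nonZero; ≢-nonZero; s≤s; z≤n)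
open import Data.Nat.Properties using (≤-trans; m*n≢0)
open import Data.Nat.Divisibility using (_∣_)
open import Data.Integer using (ℤ; +_; ∣_∣)
open import Data.Integer.Properties using (∣i∣≡0⇒i≡0)
open import Data.Integer.GCD using (gcd)
open import Data.Rational using (ℚ; ↧ₙ_; ↥_; _-_)
open import Data.Rational.Properties using (+-0-group; ↥p≡0⇒p≡0)
open import Algebra.Properties.Group +-0-group using (x∙y⁻¹≈ε⇒x≈y)
open import Data.Product using (∃; _,_; proj₁; proj₂)
open import Relation.Binary.PropositionalEquality using (_≡_; _≢_; subst; sym)
open Arithmetic using (^-distribʳ-*; M^ℓ∣t-eventually)
open AffineMaps using (affine-fixpt; iter-affine-∘; ↧ₙ-divisibility)

lemma1 : (b₁ b₂ s₁ s₂ : ℕ) (r₁ r₂ : ℤ) →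
    2 ≤ b₁ → 2 ≤ b₂ → 1 ≤ s₁ → 1 ≤ s₂ →
    gcd r₁ (+ s₁) ≡ + 1 →
    gcd r₂ (+ s₂) ≡ + 1 →
    fixpt b₁ r₁ s₁ ≢ fixpt b₂ r₂ s₂ →
    (ℓ : ℕ) →
    ∃ λ N₀ → (N : ℕ) → 1 ≤ N → N₀ ≤ N →
      (b₁ ^ ℓ) * (b₂ ^ ℓ) ∣
        ↧ₙ (iter (affine b₂ r₂ s₂) N
              (iter (affine b₁ r₁ s₁) N (fixpt b₂ r₂ s₂)))
lemma1 b₁ b₂ s₁ s₂ r₁ r₂ 2≤b₁ 2≤b₂ 1≤s₁ 1≤s₂ _ _ F≢X ℓ = N₀ , λ N N≥1 N₀≤N →
  subst (_∣ ↧ₙ R N) (^-distribʳ-* b₁ b₂ ℓ)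
    (proj₂ eventually N N≥1 N₀≤N (↧ₙ R N) (denominator-divisible N))
  where
  F = fixpt b₁ r₁ s₁
  X = fixpt b₂ r₂ s₂
  R : ℕ → ℚ
  R N = iter (affine b₂ r₂ s₂) N (iter (affine b₁ r₁ s₁) N X)
  m = ↧ₙ X * ∣ ↥ (F - X) ∣
  ∣↥[F-X]∣≢0 : ∣ ↥ (F - X) ∣ ≢ 0
  ∣↥[F-X]∣≢0 eq = F≢X (x∙y⁻¹≈ε⇒x≈y F X (↥p≡0⇒p≡0 (F - X) (∣i∣≡0⇒i≡0 eq)))
  instance
    b₁-nonZero : NonZero b₁
    b₁-nonZero = >-nonZero (≤-trans (s≤s z≤n) 2≤b₁)
    b₂-nonZero : NonZero b₂
    b₂-nonZero = >-nonZero (≤-trans (s≤s z≤n) 2≤b₂)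
    b₁b₂-nonZero : NonZero (b₁ * b₂)
    b₁b₂-nonZero = m*n≢0 b₁ b₂
    m-nonZero : NonZero m
    m-nonZero = m*n≢0 (↧ₙ X) ∣ ↥ (F - X) ∣ {{_}} {{≢-nonZero ∣↥[F-X]∣≢0}}
  eventually : ∃ λ N₀ → ∀ N → 1 ≤ N → N₀ ≤ N →
    ∀ t → (b₁ * b₂) ^ N ∣ t * (m * (b₁ ^ N ∸ 1)) → (b₁ * b₂) ^ ℓ ∣ t
  eventually = M^ℓ∣t-eventually (b₁ * b₂) b₁ m ℓ 2≤b₁
  N₀ = proj₁ eventually
  denominator-divisible : ∀ N → (b₁ * b₂) ^ N ∣ ↧ₙ R N * (m * (b₁ ^ N ∸ 1))
  denominator-divisible N = subst (_∣ ↧ₙ R N * (m * (b₁ ^ N ∸ 1))) (sym (^-distribʳ-* b₁ b₂ N))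
    (↧ₙ-divisibility (R N) X (F - X) (b₁ ^ N * b₂ ^ N) (b₁ ^ N ∸ 1)
      (iter-affine-∘ b₁ r₁ s₁ b₂ r₂ s₂ (affine-fixpt b₁ r₁ s₁ 2≤b₁ 1≤s₁) (affine-fixpt b₂ r₂ s₂ 2≤b₂ 1≤s₂) N))
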